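{- Let $X,Y$ be $\mathfrak{Q}$-preordered $\mathfrak{Q}$-subsets and $f\colon\mathsf{P}X\to\mathsf{P}Y$ a $\mathfrak{Q}$-order-preserving map. The following are equivalent: (i) $f$ is a left adjoint, i.e. there exists a $\mathfrak{Q}$-order-preserving $g\colon\mathsf{P}Y\to\mathsf{P}X$ with $f\dashv g$ a $\mathfrak{Q}$-Galois connection; (ii) $f$ is a left adjoint between the underlying preordered sets of $\mathsf{P}X$ and $\mathsf{P}Y$, and $f(u\circ\mu)=u\circ f\mu$ for all $\mu\in\mathsf{P}X$, $q\in\mathfrak{Q}$ and $u\in\mathcal{D}\mathfrak{Q}(|\mu|,q)$; (iii) $f$ is a left adjoint between the underlying preordered sets of $\mathsf{P}X$ and $\mathsf{P}Y$, and $f(u\circ\mathsf{y}_X x)=u\circ f\mathsf{y}_X x$ for all $x\in X$, $q\in\mathfrak{Q}$ and $u\in\mathcal{D}\mathfrak{Q}(|x|,q)$.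
   Context: $(\mathfrak{Q},\&,e)$ is a unital quantale (complete lattice with an associative multiplication $\&$ with unit $e$, distributing over arbitrary joins in each variable), assumed non-trivial ($\bot<e$). Implications: $p\& q\le r\iff p\le r/q\iff q\le p\backslash r$. $\mathcal{D}\mathfrak{Q}(p,q)=\{u\in\mathfrak{Q}: (u/p)\& p=u=q\&(q\backslash u)\}$. A $\mathfrak{Q}$-subset is a set $X$ with a map $|\cdot|\colon X\to\mathfrak{Q}$. A $\mathfrak{Q}$-relation $\phi\colon X\nrightarrow Y$ is a map $X\times Y\to\mathfrak{Q}$ with $\phi(x,y)\in\mathcal{D}\mathfrak{Q}(|x|,|y|)$. Composition: $(\psi\circ\phi)(x,z)=\bigvee_{y}(\psi(y,z)/|y|)\&\phi(x,y)$; identity $\mathrm{id}_X(x,x')=|x|$ if $x=x'$, $\bot$ otherwise; pointwise order. $\xi\swarrow\phi$ (for $\phi\colon X\nrightarrow Y$, $\xi\colon X\nrightarrow Z$) is the join of all $\psi'\colon Y\nrightarrow Z$ with $\psi'\circ\phi\le\xi$. $\mathbf{1}_q$ is the singleton $\{*\}$ with $|*|=q$; an element $u\in\mathcal{D}\mathfrak{Q}(p,q)$ is regarded as the $\mathfrak{Q}$-relation $\mathbf{1}_p\nrightarrow\mathbf{1}_q$ with value $u$. A $\mathfrak{Q}$-preordered $\mathfrak{Q}$-subset is a $\mathfrak{Q}$-subset $X$ with $1_X^\natural\colon X\nrightarrow X$, $\mathrm{id}_X\le 1_X^\natural$, $1_X^\natural\circ 1_X^\natural\le 1_X^\natural$.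 $\mathfrak{Q}$-order-preserving map: $|fx|=|x|$ and $1_X^\natural(x,x')\le 1_Y^\natural(fx,fx')$. Underlying preorder: $x\le y$ iff $|x|=|y|$ and $|x|\le 1_X^\natural(x,y)$; maps compared pointwise. $\mathfrak{Q}$-Galois connection $f\dashv g$: $\mathfrak{Q}$-order-preserving $f,g$ with $1\le gf$, $fg\le 1$. A left adjoint between preordered sets is a monotone map having a monotone right adjoint in the usual sense. $\mathsf{P}X$: all $\mu\colon X\nrightarrow\mathbf{1}_q$ ($q\in\mathfrak{Q}$) with $\mu\circ 1_X^\natural\le\mu$, $|\mu|=q$, $1_{\mathsf{P}X}^\natural(\mu,\mu')=\mu'\swarrow\mu$. The Yoneda embedding is $\mathsf{y}_X\colon X\to\mathsf{P}X$, $\mathsf{y}_Xx=1_X^\natural(-,x)\colon X\nrightarrow\mathbf{1}_{|x|}$. -}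

module Defs where

open import Level using (0ℓ)
open import Data.Empty using () renaming (⊥ to Empty; ⊥-elim to Empty-elim)
open import Data.Unit using (⊤; tt)
open import Data.Product using (Σ; Σ-syntax; _×_; _,_; proj₁; proj₂; ∃-syntax)
open import Relation.Nullary using (¬_)
open import Relation.Binary.PropositionalEquality using (_≡_)
open import Relation.Binary.Structures using (IsPartialOrder)

record Quantale : Set₁ where
  infixl 7 _&_
  infix 4 _≤_
  field
    Carrier        : Set
    _≤_            : Carrier → Carrier → Set
    isPartialOrder : IsPartialOrder _≡_ _≤_
    ⋁              : {I : Set} → (I → Carrier) → Carrier
    ⋁-upper        : {I : Set} (f : I → Carrier) (i : I) → f i ≤ ⋁ f
    ⋁-least        : {I : Set} (f : I → Carrier) (a : Carrier) →
                     ((i : I) → f i ≤ a) → ⋁ f ≤ a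
    _&_            : Carrier → Carrier → Carrier
    e              : Carrier
    &-assoc        : ∀ a b c → (a & b) & c ≡ a & (b & c)
    &-identityˡ    : ∀ a → e & a ≡ a
    &-identityʳ    : ∀ a → a & e ≡ a
    &-distribˡ-⋁   : ∀ a {I : Set} (f : I → Carrier) → a & ⋁ f ≡ ⋁ (λ i → a & f i)
    &-distribʳ-⋁   : ∀ a {I : Set} (f : I → Carrier) → ⋁ f & a ≡ ⋁ (λ i → f i & a)

  ⊥ : Carrier
  ⊥ = ⋁ {Empty} Empty-elim

  field
    -- non-triviality: ⊥ < e  (⊥ ≤ e holds automatically)
    nontrivial : ¬ (e ≡ ⊥)

  infixl 7 _/_ _⧹_
  -- left implication:  p ≤ r / q  iff  p & q ≤ r
  _/_ : Carrier → Carrier → Carrier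
  r / q = ⋁ {Σ Carrier (λ p → p & q ≤ r)} proj₁

  -- right implication:  q ≤ p ⧹ r  iff  p & q ≤ r
  _⧹_ : Carrier → Carrier → Carrier
  p ⧹ r = ⋁ {Σ Carrier (λ q → p & q ≤ r)} proj₁

  D : Carrier → Carrier → Carrier → Set
  D p q u = ((u / p) & p ≡ u) × (q & (q ⧹ u) ≡ u)

module _ (𝒬 : Quantale) where
  open Quantale 𝒬

  record QSubset : Set₁ where
    field
      Elt : Set
      ∣_∣ : Elt → Carrier
  open QSubset public

  𝟙 : Carrier → QSubset
  𝟙 q = record { Elt = ⊤ ; ∣_∣ = λ _ → q }

  RawRel : QSubset → QSubset → Set
  RawRel X Y = Elt X → Elt Y → Carrier

  IsQRel : (X Y : QSubset) → RawRel X Y → Set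
  IsQRel X Y φ = ∀ x y → D (∣ X ∣ x) (∣ Y ∣ y) (φ x y)

  record QRel (X Y : QSubset) : Set where
    field
      rel    : RawRel X Y
      isQRel : IsQRel X Y rel
  open QRel public

  compose : (X Y Z : QSubset) → RawRel Y Z → RawRel X Y → RawRel X Z
  compose X Y Z ψ φ x z = ⋁ {Elt Y} (λ y → (ψ y z / ∣ Y ∣ y) & φ x y)

  -- identity  id_X(x,x') = |x| if x = x', ⊥ otherwise
  -- (written as the join over the proofs of x ≡ x', which is exactly that)
  idRel : (X : QSubset) → RawRel X X
  idRel X x x' = ⋁ {x ≡ x'} (λ _ → ∣ X ∣ x)

  Sub : (X Y : QSubset) → RawRel X Y → RawRel X Y → Set
  Sub X Y φ ψ = ∀ x y → φ x y ≤ ψ x y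

  lift : (X Y Z : QSubset) → RawRel X Z → RawRel X Y → RawRel Y Z
  lift X Y Z ξ φ y z =
    ⋁ {Σ (QRel Y Z) (λ ψ' → Sub X Z (compose X Y Z (rel ψ') φ) ξ)}
      (λ w → rel (proj₁ w) y z)

  pt : (p q : Carrier) → Carrier → RawRel (𝟙 p) (𝟙 q)
  pt p q u _ _ = u

  -- 𝔔-subsets equipped with a (not necessarily lawful) 𝔔-relation
  -- X ⇸ X; the notions of order-preserving map, underlying preorder and
  -- Galois connection only depend on this data.

  record QStruct : Set₁ where
    field
      sub  : QSubset
      hom  : RawRel sub sub
  open QStruct public

  ∣_∣ₛ : (A : QStruct) → Elt (sub A) → Carrier
  ∣ A ∣ₛ = ∣ sub A ∣

  record IsQOrderPreserving (A B : QStruct) (f : Elt (sub A) → Elt (sub B)) : Set where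
    field
      pres-∣∣  : ∀ a → ∣ B ∣ₛ (f a) ≡ ∣ A ∣ₛ a
      pres-hom : ∀ a a' → hom A a a' ≤ hom B (f a) (f a')
  open IsQOrderPreserving public

  ≼ : (A : QStruct) → Elt (sub A) → Elt (sub A) → Set
  ≼ A a a' = (∣ A ∣ₛ a ≡ ∣ A ∣ₛ a') × (∣ A ∣ₛ a ≤ hom A a a')

  IsMonotone : (A B : QStruct) → (Elt (sub A) → Elt (sub B)) → Set
  IsMonotone A B f = ∀ a a' → ≼ A a a' → ≼ B (f a) (f a')

  record IsQGalois (A B : QStruct) (f : Elt (sub A) → Elt (sub B))
                   (g : Elt (sub B) → Elt (sub A)) : Set where
    field
      f-op   : IsQOrderPreserving A B f
      g-op   : IsQOrderPreserving B A g
      unit   : ∀ a → ≼ A a (g (f a))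
      counit : ∀ b → ≼ B (f (g b)) b

  IsQLeftAdjoint : (A B : QStruct) → (Elt (sub A) → Elt (sub B)) → Set
  IsQLeftAdjoint A B f = Σ (Elt (sub B) → Elt (sub A)) (λ g → IsQGalois A B f g)

  IsLeftAdjoint : (A B : QStruct) → (Elt (sub A) → Elt (sub B)) → Set
  IsLeftAdjoint A B f =
    IsMonotone A B f ×
    Σ (Elt (sub B) → Elt (sub A)) (λ g →
      IsMonotone B A g ×
      (∀ a → ≼ A a (g (f a))) ×
      (∀ b → ≼ B (f (g b)) b))

  record QPreordered : Set₁ where
    field
      carrier : QSubset
      1♮      : QRel carrier carrier
      refl♮   : Sub carrier carrier (idRel carrier) (rel 1♮)
      trans♮  : Sub carrier carrier (compose carrier carrier carrier (rel 1♮) (rel 1♮)) (rel 1♮)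
  open QPreordered public

  QPreordered→QStruct : QPreordered → QStruct
  QPreordered→QStruct X = record { sub = carrier X ; hom = rel (1♮ X) }

  record PElt (X : QPreordered) : Set where
    field
      lvl   : Carrier
      μ     : QRel (carrier X) (𝟙 lvl)
      lower : Sub (carrier X) (𝟙 lvl)
                (compose (carrier X) (carrier X) (𝟙 lvl) (rel μ) (rel (1♮ X)))
                (rel μ)
  open PElt public

  PSub : QPreordered → QSubset
  PSub X = record { Elt = PElt X ; ∣_∣ = lvl }

  P : QPreordered → QStruct
  P X = record
    { sub = PSub X
    ; hom = λ m m' → lift (carrier X) (𝟙 (lvl m)) (𝟙 (lvl m'))
                          (rel (μ m')) (rel (μ m)) tt tt }

  _≈P_ : {X : QPreordered} → PElt X → PElt X → Set
  _≈P_ {X} m m' = Σ (lvl m ≡ lvl m') (λ _ → ∀ x → rel (μ m) x tt ≡ rel (μ m') x tt)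

  IsComp : {X : QPreordered} (q u : Carrier) (m : PElt X) (ν : PElt X) → Set
  IsComp {X} q u m ν =
    Σ (lvl ν ≡ q) (λ _ → ∀ x →
      rel (μ ν) x tt ≡
      compose (carrier X) (𝟙 (lvl m)) (𝟙 q) (pt (lvl m) q u) (rel (μ m)) x tt)

  yoneda : (X : QPreordered) → Elt (carrier X) → PElt X
  yoneda X x = record
    { lvl   = ∣ carrier X ∣ x
    ; μ     = record { rel = λ x' _ → rel (1♮ X) x' x
                     ; isQRel = λ x' _ → isQRel (1♮ X) x' x }
    ; lower = λ x' _ → trans♮ X x' x }

  -- f(u ∘ μ) = u ∘ fμ  for all μ ∈ 𝖯X, q ∈ 𝔔, u ∈ 𝒟𝔔(|μ|, q)
  -- (u ∘ μ is represented by any ν ∈ 𝖯X equal to it)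
  PreservesTensors : (X Y : QPreordered) → (PElt X → PElt Y) → Set
  PreservesTensors X Y f =
    ∀ (m : PElt X) (q u : Carrier) → Quantale.D 𝒬 (lvl m) q u →
    ∀ (ν : PElt X) → IsComp q u m ν → IsComp q u (f m) (f ν)

  PreservesTensorsOnRepresentables : (X Y : QPreordered) → (PElt X → PElt Y) → Set
  PreservesTensorsOnRepresentables X Y f =
    ∀ (x : Elt (carrier X)) (q u : Carrier) →
    Quantale.D 𝒬 (∣ carrier X ∣ x) q u →
    ∀ (ν : PElt X) → IsComp q u (yoneda X x) ν →
    IsComp q u (f (yoneda X x)) (f ν)

-- Presheaves are compared through the action  (u ⊙ μ) x = (u / |μ|) & μ x :
-- w ≤ 1♮(μ, μ') holds exactly when w ⊙ μ ≤ μ' pointwise.  A 𝔔-order-preserving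
-- map h therefore always satisfies u ⊙ hμ ≤ h(u ∘ μ).  If f ⊣ g is a 𝔔-Galois
-- connection, applying this to g and transposing gives the reverse inequality
-- for f.  Conversely, if f is only an adjoint for the underlying orders, g is
-- 𝔔-order-preserving as soon as v ⊙ gβ ≤ gβ' whenever v ⊙ β ≤ β'; evaluating
-- at x this reduces, via the presheaf u ∘ 𝗒x with u = (v ⊙ gβ) x, to tensors
-- of representables, which f preserves by (iii).
module Submission where

open import Defs
open import Data.Product using (Σ; _×_; _,_; proj₁; proj₂)
open import Data.Unit using (⊤; tt)
open import Function.Bundles using (_⇔_; mk⇔)
open import Relation.Binary.PropositionalEquality
  using (_≡_; refl; sym; trans; cong; subst; subst₂)
open import Relation.Binary.Structures using (IsPartialOrder)
open import Relation.Binary.Bundles using (Poset)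
import Relation.Binary.Reasoning.PartialOrder as PartialOrderReasoning

module QuantaleProperties (𝒬 : Quantale) where
  open Quantale 𝒬
  open IsPartialOrder isPartialOrder public
    renaming (refl to ≤-refl; trans to ≤-trans; reflexive to ≤-reflexive; antisym to ≤-antisym)

  poset : Poset _ _ _
  poset = record { isPartialOrder = isPartialOrder }

  ⋁-⊤ : (f : ⊤ → Carrier) → ⋁ f ≡ f tt
  ⋁-⊤ f = ≤-antisym (⋁-least f (f tt) (λ _ → ≤-refl)) (⋁-upper f tt)

  ⋁-downset : ∀ b → ⋁ {Σ Carrier (_≤ b)} proj₁ ≡ b
  ⋁-downset b = ≤-antisym (⋁-least proj₁ b proj₂) (⋁-upper proj₁ (b , ≤-refl))

  -- Monotonicity of & comes from distributivity over the join of the down-set.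
  &-monoˡ-≤ : ∀ {a b} c → a ≤ b → a & c ≤ b & c
  &-monoˡ-≤ {a} {b} c a≤b =
    ≤-trans (⋁-upper (λ i → proj₁ i & c) (a , a≤b))
      (≤-reflexive (trans (sym (&-distribʳ-⋁ c proj₁)) (cong (_& c) (⋁-downset b))))

  &-monoʳ-≤ : ∀ c {a b} → a ≤ b → c & a ≤ c & b
  &-monoʳ-≤ c {a} {b} a≤b =
    ≤-trans (⋁-upper (λ i → c & proj₁ i) (a , a≤b))
      (≤-reflexive (trans (sym (&-distribˡ-⋁ c proj₁)) (cong (c &_) (⋁-downset b))))

  /-intro : ∀ {p q r} → p & q ≤ r → p ≤ r / q
  /-intro {q = q} {r} pq≤r = ⋁-upper (proj₁ {B = λ p → p & q ≤ r}) (_ , pq≤r)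

  /-elim : ∀ {q r} → (r / q) & q ≤ r
  /-elim {q} {r} = ≤-trans (≤-reflexive (&-distribʳ-⋁ q proj₁)) (⋁-least _ r proj₂)

  ⧹-intro : ∀ {p q r} → p & q ≤ r → q ≤ p ⧹ r
  ⧹-intro {p} {r = r} pq≤r = ⋁-upper (proj₁ {B = λ q → p & q ≤ r}) (_ , pq≤r)

  ⧹-elim : ∀ {p r} → p & (p ⧹ r) ≤ r
  ⧹-elim {p} {r} = ≤-trans (≤-reflexive (&-distribˡ-⋁ p proj₁)) (⋁-least _ r proj₂)

  w≡t&p⇒[w/p]&p≡w : ∀ {w t p} → w ≡ t & p → (w / p) & p ≡ w
  w≡t&p⇒[w/p]&p≡w {p = p} w≡t&p =
    ≤-antisym /-elim (≤-trans (≤-reflexive w≡t&p) (&-monoˡ-≤ p (/-intro (≤-reflexive (sym w≡t&p)))))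

  w≡p&t⇒p&[p⧹w]≡w : ∀ {w t p} → w ≡ p & t → p & (p ⧹ w) ≡ w
  w≡p&t⇒p&[p⧹w]≡w {p = p} w≡p&t =
    ≤-antisym ⧹-elim (≤-trans (≤-reflexive w≡p&t) (&-monoʳ-≤ p (⧹-intro (≤-reflexive (sym w≡p&t)))))

  [w/p]&r≡w&[p⧹r] : ∀ {w p r} → (w / p) & p ≡ w → p & (p ⧹ r) ≡ r →
                    (w / p) & r ≡ w & (p ⧹ r)
  [w/p]&r≡w&[p⧹r] {w} {p} {r} w-div r-div =
    trans (cong ((w / p) &_) (sym r-div)) (trans (sym (&-assoc _ _ _)) (cong (_& (p ⧹ r)) w-div))

  [[t&c]/p]&r≡t&[[c/p]&r] : ∀ {t c p r} → (c / p) & p ≡ c → ((t & c) / p) & p ≡ t & c →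
                            p & (p ⧹ r) ≡ r → ((t & c) / p) & r ≡ t & ((c / p) & r)
  [[t&c]/p]&r≡t&[[c/p]&r] {t} c-div tc-div r-div =
    trans ([w/p]&r≡w&[p⧹r] tc-div r-div)
      (trans (&-assoc _ _ _) (cong (t &_) (sym ([w/p]&r≡w&[p⧹r] c-div r-div))))

  D-refl : ∀ a → D a a a
  D-refl a = w≡t&p⇒[w/p]&p≡w (sym (&-identityˡ a)) , w≡p&t⇒p&[p⧹w]≡w (sym (&-identityʳ a))

  D-∘ : ∀ {a p q c u} → D p q u → D a p c → D a q ((u / p) & c)
  D-∘ {p = p} {c = c} {u = u} (u-div , u-codiv) (c-div , c-codiv) =
    w≡t&p⇒[w/p]&p≡w (trans (cong ((u / p) &_) (sym c-div)) (sym (&-assoc _ _ _))) ,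
    w≡p&t⇒p&[p⧹w]≡w (trans ([w/p]&r≡w&[p⧹r] u-div c-codiv)
                       (trans (cong (_& (p ⧹ c)) (sym u-codiv)) (&-assoc _ _ _)))

-- The underlying preorder of 𝖯X, read pointwise (see ≼⇒⊑ and ⊑⇒≼).
record PointwiseLe (𝒬 : Quantale) (X : QPreordered 𝒬) (m m' : PElt 𝒬 X) : Set where
  constructor _,_
  open Quantale 𝒬 using (_≤_)
  field
    lvl-≡     : lvl m ≡ lvl m'
    pointwise : ∀ x → rel (μ m) x tt ≤ rel (μ m') x tt
open PointwiseLe public

module Presheaves (𝒬 : Quantale) (X : QPreordered 𝒬) where
  open Quantale 𝒬
  open QuantaleProperties 𝒬
  open PartialOrderReasoning poset

  infix 4 _⊑_
  infixl 7 _⊙_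

  _⊑_ : PElt 𝒬 X → PElt 𝒬 X → Set
  _⊑_ = PointwiseLe 𝒬 X

  ⊑-refl : ∀ {m} → m ⊑ m
  ⊑-refl = refl , λ _ → ≤-refl

  ⊑-trans : ∀ {m m' m''} → m ⊑ m' → m' ⊑ m'' → m ⊑ m''
  ⊑-trans (eq , le) (eq' , le') = trans eq eq' , λ x → ≤-trans (le x) (le' x)

  _⊙_ : Carrier → PElt 𝒬 X → Elt (carrier X) → Carrier
  (u ⊙ m) x = (u / lvl m) & rel (μ m) x tt

  ≤hom⇒⊙≤ : ∀ m m' {w} → w ≤ hom (P 𝒬 X) m m' → ∀ x → (w ⊙ m) x ≤ rel (μ m') x tt
  ≤hom⇒⊙≤ m m' {w} w≤hom x =
    begin
      (w / a) & mx               ≡⟨ cong ((w / a) &_) (sym mx-codiv) ⟩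
      (w / a) & (a & s)          ≡⟨ sym (&-assoc _ _ _) ⟩
      ((w / a) & a) & s          ≤⟨ &-monoˡ-≤ s /-elim ⟩
      w & s                      ≤⟨ &-monoˡ-≤ s w≤hom ⟩
      hom (P 𝒬 X) m m' & s       ≡⟨ &-distribʳ-⋁ s _ ⟩
      _                          ≤⟨ ⋁-least _ _ witness≤ ⟩
      rel (μ m') x tt            ∎
    where
      a = lvl m
      mx = rel (μ m) x tt
      s = a ⧹ mx
      mx-codiv : a & s ≡ mx
      mx-codiv = proj₂ (isQRel (μ m) x tt)
      witness≤ : ∀ i → rel (proj₁ i) tt tt & s ≤ rel (μ m') x tt
      witness≤ (ψ , ψ∘m≤m') =
        ≤-trans (≤-reflexive (sym ([w/p]&r≡w&[p⧹r] (proj₁ (isQRel ψ tt tt)) mx-codiv)))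
          (≤-trans (⋁-upper (λ _ → (rel ψ tt tt / a) & mx) tt) (ψ∘m≤m' x tt))

  ⊙≤⇒≤hom : ∀ m m' {v} → D (lvl m) (lvl m') v →
            (∀ x → (v ⊙ m) x ≤ rel (μ m') x tt) → v ≤ hom (P 𝒬 X) m m'
  ⊙≤⇒≤hom m m' {v} v∈D v⊙m≤m' =
    ⋁-upper _ (record { rel = λ _ _ → v ; isQRel = λ _ _ → v∈D } ,
               λ x _ → ⋁-least _ _ (λ _ → v⊙m≤m' x))

  lvl⊙m≡m : ∀ m x → (lvl m ⊙ m) x ≡ rel (μ m) x tt
  lvl⊙m≡m m x = let mx-codiv = proj₂ (isQRel (μ m) x tt) in
    trans ([w/p]&r≡w&[p⧹r] (proj₁ (D-refl (lvl m))) mx-codiv) mx-codiv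

  ≼⇒⊑ : ∀ {m m'} → ≼ 𝒬 (P 𝒬 X) m m' → m ⊑ m'
  ≼⇒⊑ {m} {m'} (eq , a≤hom) = eq , λ x →
    ≤-trans (≤-reflexive (sym (lvl⊙m≡m m x))) (≤hom⇒⊙≤ m m' a≤hom x)

  ⊑⇒≼ : ∀ {m m'} → m ⊑ m' → ≼ 𝒬 (P 𝒬 X) m m'
  ⊑⇒≼ {m} {m'} (eq , le) = eq ,
    ⊙≤⇒≤hom m m' (subst (λ b → D (lvl m) b (lvl m)) eq (D-refl (lvl m)))
      (λ x → ≤-trans (≤-reflexive (lvl⊙m≡m m x)) (le x))

  ⊙-monoʳ-⊑ : ∀ u {m m'} → m ⊑ m' → ∀ x → (u ⊙ m) x ≤ (u ⊙ m') x
  ⊙-monoʳ-⊑ u {m} {m'} (eq , le) x =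
    ≤-trans (&-monoʳ-≤ (u / lvl m) (le x))
      (≤-reflexive (cong (λ a → (u / a) & rel (μ m') x tt) eq))

  &-⊙-assoc : ∀ {t c} m → (c / lvl m) & lvl m ≡ c → ((t & c) / lvl m) & lvl m ≡ t & c →
              ∀ x → ((t & c) ⊙ m) x ≡ t & (c ⊙ m) x
  &-⊙-assoc m c-div tc-div x =
    [[t&c]/p]&r≡t&[[c/p]&r] c-div tc-div (proj₂ (isQRel (μ m) x tt))

  IsComp⇒≡⊙ : ∀ {q u m ν} → IsComp 𝒬 q u m ν → ∀ x → rel (μ ν) x tt ≡ (u ⊙ m) x
  IsComp⇒≡⊙ (_ , ν≡u∘m) x = trans (ν≡u∘m x) (⋁-⊤ _)

  tensor : (m : PElt 𝒬 X) (q u : Carrier) → D (lvl m) q u → PElt 𝒬 X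
  tensor m q u u∈D = record
    { lvl = q
    ; μ = record { rel = λ x _ → (u ⊙ m) x ; isQRel = λ x _ → D-∘ u∈D (isQRel (μ m) x tt) }
    ; lower = λ x _ → ⋁-least _ _ (lower-at x) }
    where
      lower-at : ∀ x y → ((u ⊙ m) y / ∣ carrier X ∣ y) & rel (1♮ X) x y ≤ (u ⊙ m) x
      lower-at x y =
        begin
          ((u ⊙ m) y / ∣y∣) & r          ≡⟨ [[t&c]/p]&r≡t&[[c/p]&r] my-div (proj₁ (D-∘ u∈D my∈D)) r-codiv ⟩
          (u / lvl m) & ((my / ∣y∣) & r)  ≤⟨ &-monoʳ-≤ (u / lvl m) my∘r≤mx ⟩
          (u ⊙ m) x                      ∎
        where
          ∣y∣ = ∣ carrier X ∣ y
          r = rel (1♮ X) x y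
          my = rel (μ m) y tt
          my∈D = isQRel (μ m) y tt
          my-div = proj₁ my∈D
          r-codiv = proj₂ (isQRel (1♮ X) x y)
          my∘r≤mx : (my / ∣y∣) & r ≤ rel (μ m) x tt
          my∘r≤mx = ≤-trans (⋁-upper (λ z → (rel (μ m) z tt / ∣ carrier X ∣ z) & rel (1♮ X) x z) y)
                            (lower m x tt)

  tensor-IsComp : ∀ m q u (u∈D : D (lvl m) q u) → IsComp 𝒬 q u m (tensor m q u u∈D)
  tensor-IsComp m q u u∈D = refl , λ _ → sym (⋁-⊤ _)

  tensor-yoneda-⊑ : ∀ m x → tensor (yoneda 𝒬 X x) (lvl m) (rel (μ m) x tt) (isQRel (μ m) x tt) ⊑ m
  tensor-yoneda-⊑ m x = refl , λ x' →
    ≤-trans (⋁-upper (λ y → (rel (μ m) y tt / ∣ carrier X ∣ y) & rel (1♮ X) x' y) x) (lower m x' tt)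

  ≤-⊙-yoneda-self : ∀ {q u} x → D (∣ carrier X ∣ x) q u → u ≤ (u ⊙ yoneda 𝒬 X x) x
  ≤-⊙-yoneda-self x (u-div , _) =
    ≤-trans (≤-reflexive (sym u-div))
      (&-monoʳ-≤ _ (≤-trans (⋁-upper (λ (_ : x ≡ x) → ∣ carrier X ∣ x) refl) (refl♮ X x x)))

module Maps (𝒬 : Quantale) where
  open Quantale 𝒬
  open QuantaleProperties 𝒬
  open IsQGalois

  QOrderPreserving⇒Monotone : {A B : QStruct 𝒬} {f : Elt (sub A) → Elt (sub B)} →
    IsQOrderPreserving 𝒬 A B f → IsMonotone 𝒬 A B f
  QOrderPreserving⇒Monotone fop a a' (eq , a≤hom) =
    trans (pres-∣∣ fop a) (trans eq (sym (pres-∣∣ fop a'))) ,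
    ≤-trans (≤-reflexive (pres-∣∣ fop a)) (≤-trans a≤hom (pres-hom fop a a'))

  QGalois⇒LeftAdjoint : {A B : QStruct 𝒬} {f : Elt (sub A) → Elt (sub B)}
    {g : Elt (sub B) → Elt (sub A)} → IsQGalois 𝒬 A B f g → IsLeftAdjoint 𝒬 A B f
  QGalois⇒LeftAdjoint {g = g} G =
    QOrderPreserving⇒Monotone (f-op G) , g , QOrderPreserving⇒Monotone (g-op G) , unit G , counit G

  module _ {X Y : QPreordered 𝒬} where
    private
      module PX = Presheaves 𝒬 X
      module PY = Presheaves 𝒬 Y

    ⊙-lax : {h : PElt 𝒬 X → PElt 𝒬 Y} → IsQOrderPreserving 𝒬 (P 𝒬 X) (P 𝒬 Y) h →
      ∀ {m q u ν} → D (lvl m) q u → IsComp 𝒬 q u m ν →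
      ∀ y → (u PY.⊙ h m) y ≤ rel (μ (h ν)) y tt
    ⊙-lax {h} hop {m} {u = u} {ν} u∈D ν≡u∘m@(lvl-ν , _) =
      PY.≤hom⇒⊙≤ (h m) (h ν)
        (≤-trans (PX.⊙≤⇒≤hom m ν (subst (λ b → D (lvl m) b u) (sym lvl-ν) u∈D)
                   (λ x → ≤-reflexive (sym (PX.IsComp⇒≡⊙ {m = m} {ν} ν≡u∘m x))))
                 (pres-hom hop m ν))

  -- A separate block, so that ⊙-lax above can be used with X and Y swapped.
  module _ {X Y : QPreordered 𝒬} where
    private
      module PX = Presheaves 𝒬 X
      module PY = Presheaves 𝒬 Y
    open PartialOrderReasoning poset

    module UnderlyingAdjunction {f : PElt 𝒬 X → PElt 𝒬 Y}
                                (adj : IsLeftAdjoint 𝒬 (P 𝒬 X) (P 𝒬 Y) f) where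
      g : PElt 𝒬 Y → PElt 𝒬 X
      g = proj₁ (proj₂ adj)

      f⊑⇒⊑g : ∀ {ν b} → f ν PY.⊑ b → ν PX.⊑ g b
      f⊑⇒⊑g {ν} {b} fν⊑b = let (_ , _ , g-mono , unit , _) = adj in
        PX.⊑-trans {m' = g (f ν)} (PX.≼⇒⊑ (unit ν)) (PX.≼⇒⊑ (g-mono (f ν) b (PY.⊑⇒≼ fν⊑b)))

      ⊑g⇒f⊑ : ∀ {ν b} → ν PX.⊑ g b → f ν PY.⊑ b
      ⊑g⇒f⊑ {ν} {b} ν⊑gb = let (f-mono , _ , _ , _ , counit) = adj in
        PY.⊑-trans {m' = f (g b)} (PY.≼⇒⊑ (f-mono ν (g b) (PX.⊑⇒≼ ν⊑gb))) (PY.≼⇒⊑ (counit b))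

    QGalois⇒PreservesTensors : {f : PElt 𝒬 X → PElt 𝒬 Y} {g : PElt 𝒬 Y → PElt 𝒬 X} →
      IsQGalois 𝒬 (P 𝒬 X) (P 𝒬 Y) f g → PreservesTensors 𝒬 X Y f
    QGalois⇒PreservesTensors {f} {g} G m q u u∈D ν ν≡u∘m@(lvl-ν , _) =
      trans (pres-∣∣ (f-op G) ν) lvl-ν ,
      λ y → trans (≤-antisym (pointwise fν⊑θ y) (⊙-lax (f-op G) u∈D ν≡u∘m y)) (sym (⋁-⊤ _))
      where
        open UnderlyingAdjunction (QGalois⇒LeftAdjoint G) using (⊑g⇒f⊑)
        u∈D' : D (lvl (f m)) q u
        u∈D' = subst (λ a → D a q u) (sym (pres-∣∣ (f-op G) m)) u∈D
        θ : PElt 𝒬 Y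
        θ = PY.tensor (f m) q u u∈D'
        ν⊑gθ : ν PX.⊑ g θ
        ν⊑gθ = trans lvl-ν (sym (pres-∣∣ (g-op G) θ)) , λ x →
          begin
            rel (μ ν) x tt       ≡⟨ PX.IsComp⇒≡⊙ {m = m} {ν} ν≡u∘m x ⟩
            (u PX.⊙ m) x         ≤⟨ PX.⊙-monoʳ-⊑ u (PX.≼⇒⊑ {m} {g (f m)} (unit G m)) x ⟩
            (u PX.⊙ g (f m)) x   ≤⟨ ⊙-lax (g-op G) u∈D' (PY.tensor-IsComp (f m) q u u∈D') x ⟩
            rel (μ (g θ)) x tt   ∎
        fν⊑θ : f ν PY.⊑ θ
        fν⊑θ = ⊑g⇒f⊑ ν⊑gθ

    module _ {f : PElt 𝒬 X → PElt 𝒬 Y} (fop : IsQOrderPreserving 𝒬 (P 𝒬 X) (P 𝒬 Y) f)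
             (adj : IsLeftAdjoint 𝒬 (P 𝒬 X) (P 𝒬 Y) f)
             (f-tensor-yoneda : PreservesTensorsOnRepresentables 𝒬 X Y f) where
      open UnderlyingAdjunction adj

      lvl-g : ∀ b → lvl (g b) ≡ lvl b
      lvl-g b = trans (sym (pres-∣∣ fop (g b))) (lvl-≡ (⊑g⇒f⊑ {g b} {b} PX.⊑-refl))

      ⊙-f-yoneda-≤ : ∀ b x y → (rel (μ (g b)) x tt PY.⊙ f (yoneda 𝒬 X x)) y ≤ rel (μ b) y tt
      ⊙-f-yoneda-≤ b x y =
        begin
          (c PY.⊙ f yx) y      ≡⟨ sym (PY.IsComp⇒≡⊙ {m = f yx} {f ν} fν≡c∘fyx y) ⟩
          rel (μ (f ν)) y tt   ≤⟨ pointwise (⊑g⇒f⊑ (PX.tensor-yoneda-⊑ (g b) x)) y ⟩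
          rel (μ b) y tt       ∎
        where
          yx = yoneda 𝒬 X x
          c = rel (μ (g b)) x tt
          c∈D = isQRel (μ (g b)) x tt
          ν = PX.tensor yx (lvl (g b)) c c∈D
          fν≡c∘fyx = f-tensor-yoneda x (lvl (g b)) c c∈D ν (PX.tensor-IsComp yx _ c c∈D)

      -- Evaluate at x through u ∘ 𝗒x, where u = (v ⊙ g b) x: transposing
      -- f(u ∘ 𝗒x) = (v / |b|) ∘ f(c ∘ 𝗒x) ⊑ (v / |b|) ∘ b ⊑ b' gives u ∘ 𝗒x ⊑ g b'.
      g-preserves-⊙≤ : ∀ b b' {v} → D (lvl b) (lvl b') v →
        (∀ y → (v PY.⊙ b) y ≤ rel (μ b') y tt) → ∀ x → (v PX.⊙ g b) x ≤ rel (μ (g b')) x tt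
      g-preserves-⊙≤ b b' {v} v∈D v⊙b≤b' x =
        ≤-trans (PX.≤-⊙-yoneda-self x u∈D) (pointwise (f⊑⇒⊑g fν⊑b') x)
        where
          yx = yoneda 𝒬 X x
          c = rel (μ (g b)) x tt
          c∈D = isQRel (μ (g b)) x tt
          u = (v PX.⊙ g b) x
          u∈D : D (∣ carrier X ∣ x) (lvl b') u
          u∈D = D-∘ (subst (λ a → D a (lvl b') v) (sym (lvl-g b)) v∈D) c∈D
          ν = PX.tensor yx (lvl b') u u∈D
          fν≡u∘fyx = f-tensor-yoneda x (lvl b') u u∈D ν (PX.tensor-IsComp yx _ u u∈D)
          divides-at-fyx : ∀ {w q} → D (∣ carrier X ∣ x) q w → (w / lvl (f yx)) & lvl (f yx) ≡ w
          divides-at-fyx {w} w∈D = subst (λ a → (w / a) & a ≡ w) (sym (pres-∣∣ fop yx)) (proj₁ w∈D)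
          fν⊑b' : f ν PY.⊑ b'
          fν⊑b' = proj₁ fν≡u∘fyx , λ y →
            begin
              rel (μ (f ν)) y tt                       ≡⟨ PY.IsComp⇒≡⊙ {m = f yx} {f ν} fν≡u∘fyx y ⟩
              (u PY.⊙ f yx) y                          ≡⟨ PY.&-⊙-assoc (f yx) (divides-at-fyx c∈D) (divides-at-fyx u∈D) y ⟩
              (v / lvl (g b)) & (c PY.⊙ f yx) y        ≤⟨ &-monoʳ-≤ (v / lvl (g b)) (⊙-f-yoneda-≤ b x y) ⟩
              (v / lvl (g b)) & rel (μ b) y tt         ≡⟨ cong (λ a → (v / a) & rel (μ b) y tt) (lvl-g b) ⟩
              (v PY.⊙ b) y                             ≤⟨ v⊙b≤b' y ⟩
              rel (μ b') y tt                          ∎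

      rightAdjoint-isQOrderPreserving : IsQOrderPreserving 𝒬 (P 𝒬 Y) (P 𝒬 X) g
      rightAdjoint-isQOrderPreserving = record
        { pres-∣∣  = lvl-g
        ; pres-hom = λ b b' → ⋁-least _ _ λ (ψ , ψ∘b≤b') →
            PX.⊙≤⇒≤hom (g b) (g b')
              (subst₂ (λ a a' → D a a' _) (sym (lvl-g b)) (sym (lvl-g b')) (isQRel ψ tt tt))
              (g-preserves-⊙≤ b b' (isQRel ψ tt tt) (λ y → ≤-trans (⋁-upper _ tt) (ψ∘b≤b' y tt)))
        }

      LeftAdjoint⇒QLeftAdjoint : IsQLeftAdjoint 𝒬 (P 𝒬 X) (P 𝒬 Y) f
      LeftAdjoint⇒QLeftAdjoint = let (_ , _ , _ , unit , counit) = adj in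
        g , record { f-op = fop ; g-op = rightAdjoint-isQOrderPreserving ; unit = unit ; counit = counit }

proposition4p15 : (𝒬 : Quantale) (X Y : QPreordered 𝒬)
    (f : PElt 𝒬 X → PElt 𝒬 Y) →
    IsQOrderPreserving 𝒬 (P 𝒬 X) (P 𝒬 Y) f →
    (IsQLeftAdjoint 𝒬 (P 𝒬 X) (P 𝒬 Y) f
    ⇔ (IsLeftAdjoint 𝒬 (P 𝒬 X) (P 𝒬 Y) f × PreservesTensors 𝒬 X Y f))
    × (IsQLeftAdjoint 𝒬 (P 𝒬 X) (P 𝒬 Y) f
    ⇔ (IsLeftAdjoint 𝒬 (P 𝒬 X) (P 𝒬 Y) f
    × PreservesTensorsOnRepresentables 𝒬 X Y f))
proposition4p15 𝒬 X Y f fop =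
  mk⇔ (λ (_ , G) → QGalois⇒LeftAdjoint G , QGalois⇒PreservesTensors G)
      (λ (adj , preserves) → LeftAdjoint⇒QLeftAdjoint fop adj (onRepresentables preserves)) ,
  mk⇔ (λ (_ , G) → QGalois⇒LeftAdjoint G , onRepresentables (QGalois⇒PreservesTensors G))
      (λ (adj , preserves) → LeftAdjoint⇒QLeftAdjoint fop adj preserves)
  where
    open Maps 𝒬
    onRepresentables : PreservesTensors 𝒬 X Y f → PreservesTensorsOnRepresentables 𝒬 X Y f
    onRepresentables preserves x = preserves (yoneda 𝒬 X x)
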